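{- Let $G$ be a finite $d$-regular graph with $n$ vertices. Suppose $S_1$ is an independent exact $r_1$-cover of $G$, $S_2$ is an independent exact $r_2$-cover of $G$, and $r_1 \neq r_2$. Then \[|S_1 \cap S_2| = \frac{|S_1|\,|S_2|}{n} = \frac{r_1 r_2 n}{(d+r_1)(d+r_2)}.\]
   Context: Let $G$ be a $d$-regular simple graph. For $0 \le r \le d$, an independent exact $r$-cover of $G$ is a subset $S \subseteq V(G)$ such that no edge of $G$ has both endpoints in $S$, and every vertex of $V(G)\setminus S$ is adjacent to exactly $r$ vertices of $S$. -}

module Defs where

open import Data.Bool using (Bool; true; false; T)
open import Data.Nat using (ℕ)
open import Data.Fin using (Fin)
open import Data.Fin.Subset using (Subset; _∈_; _∉_; _∩_; ∣_∣)
open import Data.Vec using (tabulate)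
open import Relation.Binary.PropositionalEquality using (_≡_)
open import Relation.Nullary using (¬_)

record Graph (n : ℕ) : Set where
  field
    adj     : Fin n → Fin n → Bool
    symm    : ∀ u v → adj u v ≡ adj v u
    irrefl  : ∀ v → adj v v ≡ false

open Graph public

nbhd : ∀ {n} → Graph n → Fin n → Subset n
nbhd G v = tabulate (adj G v)

Regular : ∀ {n} → Graph n → ℕ → Set
Regular G d = ∀ v → ∣ nbhd G v ∣ ≡ d

Independent : ∀ {n} → Graph n → Subset n → Set
Independent G S = ∀ u v → u ∈ S → v ∈ S → ¬ T (adj G u v)

IndepExactCover : ∀ {n} → Graph n → ℕ → Subset n → Set
IndepExactCover G r S =
  Independent G S × (∀ v → v ∉ S → ∣ nbhd G v ∩ S ∣ ≡ r)
  where open import Data.Product using (_×_)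

{-# OPTIONS --safe #-}
-- Let A be the adjacency matrix of G and χ S the indicator vector of S. That S is an
-- independent exact r-cover says exactly (A + r I) χ S = r 𝟏. Pairing this with 𝟏 and using
-- A 𝟏 = d 𝟏 gives (d + r) ∣S∣ = r n. Pairing the equation for S₂ with χ S₁, and the one for S₁
-- with χ S₂, gives, by symmetry of A, e + r₂ ∣S₁ ∩ S₂∣ = r₂ ∣S₁∣ and e + r₁ ∣S₁ ∩ S₂∣ = r₁ ∣S₂∣
-- with the same e = ⟨χ S₁, A χ S₂⟩. As r₁ ≢ r₂ these determine ∣S₁ ∩ S₂∣, and substituting
-- the sizes gives both formulas (cross-multiplied, since everything lives in ℕ).
module Submission where

open import Defs
open import Data.Nat using (ℕ; zero; suc; _+_; _*_; _≤_; _<_; _∸_; z≤n; NonZero; >-nonZero)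
open import Data.Nat.Properties
open import Data.Nat.Tactic.RingSolver using (solve-∀)
open import Data.Bool using (Bool; true; false; _∧_; T)
open import Data.Fin using (Fin)
open import Data.Fin.Subset using (Subset; _∈_; _∩_; ∣_∣)
open import Data.Fin.Subset.Properties using (∩-comm)
open import Data.Vec using ([]; _∷_; lookup)
open import Data.Vec.Properties using (lookup∘tabulate; lookup-zipWith; []=⇒lookup; lookup⇒[]=)
open import Data.Vec.Functional using (Vector; replicate)
open import Data.Product using (_×_; _,_)
open import Data.Unit using (tt)
open import Data.Empty using (⊥-elim)
open import Relation.Nullary using (¬_)
open import Relation.Binary using (tri<; tri≈; tri>)
open import Relation.Binary.PropositionalEquality
  using (_≡_; _≢_; refl; sym; trans; cong; cong₂; subst; module ≡-Reasoning)
open import Algebra.Properties.CommutativeSemigroup +-commutativeSemigroup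
  using () renaming (xy∙z≈xz∙y to +-right-comm)
open import Algebra.Properties.CommutativeSemigroup *-commutativeSemigroup
  using () renaming (xy∙z≈xz∙y to *-right-comm)
open import Algebra.Properties.Semiring.Sum +-*-semiring
  using ( sum; sum-syntax; sum-cong-≗; sum-replicate-zero; ∑-distrib-+; ∑-comm
        ; *-distribˡ-sum; *-distribʳ-sum)

open ≡-Reasoning

𝟙 : Bool → ℕ
𝟙 true  = 1
𝟙 false = 0

𝟙-∧ : ∀ a b → 𝟙 (a ∧ b) ≡ 𝟙 a * 𝟙 b
𝟙-∧ true  b = sym (+-identityʳ (𝟙 b))
𝟙-∧ false b = refl

sum-replicate-1 : ∀ n → sum (replicate n 1) ≡ n
sum-replicate-1 zero    = refl
sum-replicate-1 (suc n) = cong suc (sum-replicate-1 n)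

⟨_,_⟩ : ∀ {n} → Vector ℕ n → Vector ℕ n → ℕ
⟨ f , g ⟩ = sum (λ i → f i * g i)

⟨⟩-comm : ∀ {n} (f g : Vector ℕ n) → ⟨ f , g ⟩ ≡ ⟨ g , f ⟩
⟨⟩-comm f g = sum-cong-≗ (λ i → *-comm (f i) (g i))

χ : ∀ {n} → Subset n → Vector ℕ n
χ p i = 𝟙 (lookup p i)

∣p∣≡∑χp : ∀ {n} (p : Subset n) → ∣ p ∣ ≡ sum (χ p)
∣p∣≡∑χp []          = refl
∣p∣≡∑χp (true ∷ p)  = cong suc (∣p∣≡∑χp p)
∣p∣≡∑χp (false ∷ p) = ∣p∣≡∑χp p

∣p∩q∣≡⟨χp,χq⟩ : ∀ {n} (p q : Subset n) → ∣ p ∩ q ∣ ≡ ⟨ χ p , χ q ⟩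
∣p∩q∣≡⟨χp,χq⟩ p q = trans (∣p∣≡∑χp (p ∩ q)) (sum-cong-≗ λ i →
  trans (cong 𝟙 (lookup-zipWith _∧_ i p q)) (𝟙-∧ (lookup p i) (lookup q i)))

module Adjacency {n : ℕ} (G : Graph n) where

  A : Fin n → Fin n → ℕ
  A u v = 𝟙 (adj G u v)

  A-symmetric : ∀ u v → A u v ≡ A v u
  A-symmetric u v = cong 𝟙 (symm G u v)

  A·_ : Vector ℕ n → Vector ℕ n
  (A· f) u = ∑[ v < n ] (A u v * f v)

  ⟨f,A·g⟩≡⟨g,A·f⟩ : ∀ f g → ⟨ f , A· g ⟩ ≡ ⟨ g , A· f ⟩
  ⟨f,A·g⟩≡⟨g,A·f⟩ f g = begin
    ∑[ u < n ] (f u * ∑[ v < n ] (A u v * g v))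
      ≡⟨ sum-cong-≗ (λ u → *-distribˡ-sum (f u) (λ v → A u v * g v)) ⟩
    ∑[ u < n ] ∑[ v < n ] (f u * (A u v * g v))
      ≡⟨ sum-cong-≗ (λ u → sum-cong-≗ (λ v → transpose u v)) ⟩
    ∑[ u < n ] ∑[ v < n ] (g v * (A v u * f u))
      ≡⟨ ∑-comm (λ u v → g v * (A v u * f u)) ⟩
    ∑[ v < n ] ∑[ u < n ] (g v * (A v u * f u))
      ≡⟨ sum-cong-≗ (λ v → *-distribˡ-sum (g v) (λ u → A v u * f u)) ⟨
    ∑[ v < n ] (g v * ∑[ u < n ] (A v u * f u))
      ∎
    where
    x·yz≡z·yx : ∀ x y z → x * (y * z) ≡ z * (y * x)
    x·yz≡z·yx = solve-∀
    transpose : ∀ u v → f u * (A u v * g v) ≡ g v * (A v u * f u)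
    transpose u v =
      trans (cong (λ a → f u * (a * g v)) (A-symmetric u v)) (x·yz≡z·yx (f u) (A v u) (g v))

  χ-nbhd : ∀ u v → χ (nbhd G u) v ≡ A u v
  χ-nbhd u v = cong 𝟙 (lookup∘tabulate (adj G u) v)

  ∣N∩S∣≡A·χS : ∀ u S → ∣ nbhd G u ∩ S ∣ ≡ (A· χ S) u
  ∣N∩S∣≡A·χS u S = trans (∣p∩q∣≡⟨χp,χq⟩ (nbhd G u) S)
    (sum-cong-≗ (λ v → cong (_* χ S v) (χ-nbhd u v)))

  regular⇒A·1≡d : ∀ {d} → Regular G d → ∀ u → (A· replicate n 1) u ≡ d
  regular⇒A·1≡d {d} reg u = begin
    ∑[ v < n ] (A u v * 1)  ≡⟨ sum-cong-≗ (λ v → trans (*-identityʳ (A u v)) (sym (χ-nbhd u v))) ⟩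
    sum (χ (nbhd G u))      ≡⟨ ∣p∣≡∑χp (nbhd G u) ⟨
    ∣ nbhd G u ∣            ≡⟨ reg u ⟩
    d                       ∎

  independent⇒A·χ≡0 : ∀ {S} → Independent G S → ∀ {u} → u ∈ S → (A· χ S) u ≡ 0
  independent⇒A·χ≡0 {S} ind {u} u∈S = trans (sum-cong-≗ no-edge) (sum-replicate-zero n)
    where
    no-edge : ∀ v → A u v * χ S v ≡ 0
    no-edge v with lookup S v in S[v] | adj G u v in uv
    ... | false | b     = *-zeroʳ (𝟙 b)
    ... | true  | false = refl
    ... | true  | true  = ⊥-elim (ind u v u∈S (lookup⇒[]= v S S[v]) (subst T (sym uv) tt))

  cover-equation : ∀ {r S} → IndepExactCover G r S → ∀ u → (A· χ S) u + r * χ S u ≡ r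
  cover-equation {r} {S} (ind , exact) u with lookup S u in S[u]
  ... | true  =
    trans (cong (_+ r * 1) (independent⇒A·χ≡0 ind (lookup⇒[]= u S S[u]))) (*-identityʳ r)
  ... | false = begin
    (A· χ S) u + r * 0  ≡⟨ cong ((A· χ S) u +_) (*-zeroʳ r) ⟩
    (A· χ S) u + 0      ≡⟨ +-identityʳ _ ⟩
    (A· χ S) u          ≡⟨ ∣N∩S∣≡A·χS u S ⟨
    ∣ nbhd G u ∩ S ∣    ≡⟨ exact u u∉S ⟩
    r                   ∎
    where
    u∉S : ¬ (u ∈ S)
    u∉S u∈S with () ← trans (sym ([]=⇒lookup u∈S)) S[u]

  cover-pairing : ∀ {r S} → IndepExactCover G r S →
                  ∀ f → ⟨ f , A· χ S ⟩ + r * ⟨ f , χ S ⟩ ≡ r * sum f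
  cover-pairing {r} {S} cover f = begin
    ⟨ f , A· χ S ⟩ + r * ⟨ f , χ S ⟩
      ≡⟨ cong (⟨ f , A· χ S ⟩ +_) (*-distribˡ-sum r (λ u → f u * χ S u)) ⟩
    ⟨ f , A· χ S ⟩ + ∑[ u < n ] (r * (f u * χ S u))
      ≡⟨ ∑-distrib-+ (λ u → f u * (A· χ S) u) (λ u → r * (f u * χ S u)) ⟨
    ∑[ u < n ] (f u * (A· χ S) u + r * (f u * χ S u))
      ≡⟨ sum-cong-≗ (λ u → trans (factor (f u) _ r _) (cong (f u *_) (cover-equation cover u))) ⟩
    ∑[ u < n ] (f u * r)
      ≡⟨ *-distribʳ-sum r f ⟨
    sum f * r
      ≡⟨ *-comm (sum f) r ⟩
    r * sum f
      ∎
    where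
    factor : ∀ a b r c → a * b + r * (a * c) ≡ a * (b + r * c)
    factor = solve-∀

  cover-size : ∀ {d r S} → Regular G d → IndepExactCover G r S → (d + r) * ∣ S ∣ ≡ r * n
  cover-size {d} {r} {S} reg cover = begin
    (d + r) * ∣ S ∣                           ≡⟨ *-distribʳ-+ ∣ S ∣ d r ⟩
    d * ∣ S ∣ + r * ∣ S ∣                     ≡⟨ cong₂ (λ a b → a + r * b) degree-count count ⟩
    ⟨ 𝟏 , A· χ S ⟩ + r * ⟨ 𝟏 , χ S ⟩          ≡⟨ cover-pairing cover 𝟏 ⟩
    r * sum 𝟏                                 ≡⟨ cong (r *_) (sum-replicate-1 n) ⟩
    r * n                                     ∎
    where
    𝟏 : Vector ℕ n
    𝟏 = replicate n 1
    count : ∣ S ∣ ≡ ⟨ 𝟏 , χ S ⟩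
    count = trans (∣p∣≡∑χp S) (sum-cong-≗ (λ u → sym (*-identityˡ (χ S u))))
    degree-count : d * ∣ S ∣ ≡ ⟨ 𝟏 , A· χ S ⟩
    degree-count = begin
      d * ∣ S ∣                   ≡⟨ cong (d *_) (∣p∣≡∑χp S) ⟩
      d * sum (χ S)               ≡⟨ *-distribˡ-sum d (χ S) ⟩
      ∑[ u < n ] (d * χ S u)      ≡⟨ sum-cong-≗ (λ u → cong (_* χ S u) (regular⇒A·1≡d reg u)) ⟨
      ⟨ A· 𝟏 , χ S ⟩              ≡⟨ ⟨⟩-comm (A· 𝟏) (χ S) ⟩
      ⟨ χ S , A· 𝟏 ⟩              ≡⟨ ⟨f,A·g⟩≡⟨g,A·f⟩ (χ S) 𝟏 ⟩
      ⟨ 𝟏 , A· χ S ⟩              ∎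

  cover-intersection : ∀ {r T} → IndepExactCover G r T →
                       ∀ S → ⟨ χ S , A· χ T ⟩ + r * ∣ S ∩ T ∣ ≡ r * ∣ S ∣
  cover-intersection {r} {T} cover S = begin
    ⟨ χ S , A· χ T ⟩ + r * ∣ S ∩ T ∣         ≡⟨ cong (λ k → ⟨ χ S , A· χ T ⟩ + r * k) (∣p∩q∣≡⟨χp,χq⟩ S T) ⟩
    ⟨ χ S , A· χ T ⟩ + r * ⟨ χ S , χ T ⟩     ≡⟨ cover-pairing cover (χ S) ⟩
    r * sum (χ S)                            ≡⟨ cong (r *_) (∣p∣≡∑χp S) ⟨
    r * ∣ S ∣                                ∎

cross-cancel : ∀ {r₁ r₂ y z} → r₁ < r₂ → r₁ * y + r₂ * z ≡ r₁ * z + r₂ * y → y ≡ z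
cross-cancel {r₁} {r₂} {y} {z} r₁<r₂ eq =
  sym (*-cancelˡ-≡ _ _ k {{>-nonZero (m<n⇒0<n∸m r₁<r₂)}} (+-cancelˡ-≡ (r₁ * y + r₁ * z) _ _ (begin
    r₁ * y + r₁ * z + k * z  ≡⟨ split r₁ k y z ⟩
    r₁ * y + (r₁ + k) * z    ≡⟨ cong (λ r → r₁ * y + r * z) r₁+k≡r₂ ⟩
    r₁ * y + r₂ * z          ≡⟨ eq ⟩
    r₁ * z + r₂ * y          ≡⟨ cong (λ r → r₁ * z + r * y) r₁+k≡r₂ ⟨
    r₁ * z + (r₁ + k) * y    ≡⟨ split r₁ k z y ⟨
    r₁ * z + r₁ * y + k * y  ≡⟨ cong (_+ k * y) (+-comm (r₁ * z) (r₁ * y)) ⟩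
    r₁ * y + r₁ * z + k * y  ∎)))
  where
  k = r₂ ∸ r₁
  r₁+k≡r₂ : r₁ + k ≡ r₂
  r₁+k≡r₂ = m+[n∸m]≡n (<⇒≤ r₁<r₂)
  split : ∀ r k y z → r * y + r * z + k * z ≡ r * y + (r + k) * z
  split = solve-∀

cross-cancel-≢ : ∀ {r₁ r₂ y z} → r₁ ≢ r₂ → r₁ * y + r₂ * z ≡ r₁ * z + r₂ * y → y ≡ z
cross-cancel-≢ {r₁} {r₂} {y} {z} r₁≢r₂ eq with <-cmp r₁ r₂
... | tri< r₁<r₂ _ _ = cross-cancel r₁<r₂ eq
... | tri≈ _ r₁≡r₂ _ = ⊥-elim (r₁≢r₂ r₁≡r₂)
... | tri> _ _ r₂<r₁ =
  sym (cross-cancel r₂<r₁ (trans (+-comm (r₂ * z) (r₁ * y)) (trans eq (+-comm (r₁ * z) (r₂ * y)))))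

intersection-equation : ∀ {n d r₁ r₂ s₁ s₂ e x} → r₁ ≢ r₂ →
  (d + r₁) * s₁ ≡ r₁ * n → (d + r₂) * s₂ ≡ r₂ * n →
  e + r₂ * x ≡ r₂ * s₁ → e + r₁ * x ≡ r₁ * s₂ →
  x * ((d + r₁) * (d + r₂)) ≡ r₁ * r₂ * n
-- Eliminating e leaves (r₂ - r₁) x = r₂ s₁ - r₁ s₂; after multiplying by D and substituting
-- the sizes, this is (r₂ - r₁) (x D) = (r₂ - r₁) m, stated below without subtraction.
intersection-equation {n} {d} {r₁} {r₂} {s₁} {s₂} {e} {x} r₁≢r₂ size₁ size₂ pair₂ pair₁ =
  cross-cancel-≢ r₁≢r₂ (+-cancelˡ-≡ (m * d) _ _ (begin
    m * d + (r₁ * X + r₂ * m)                ≡⟨ collect₁ n d r₁ r₂ X ⟨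
    r₂ * (d + r₂) * (r₁ * n) + r₁ * X        ≡⟨ cong (λ a → r₂ * (d + r₂) * a + r₁ * X) size₁ ⟨
    r₂ * (d + r₂) * ((d + r₁) * s₁) + r₁ * X ≡⟨ expand₁ d r₁ r₂ s₁ x ⟨
    (r₂ * s₁ + r₁ * x) * D                   ≡⟨ cong (_* D) e-eliminated ⟩
    (r₁ * s₂ + r₂ * x) * D                   ≡⟨ expand₂ d r₁ r₂ s₂ x ⟩
    r₁ * (d + r₁) * ((d + r₂) * s₂) + r₂ * X ≡⟨ cong (λ a → r₁ * (d + r₁) * a + r₂ * X) size₂ ⟩
    r₁ * (d + r₁) * (r₂ * n) + r₂ * X        ≡⟨ collect₂ n d r₁ r₂ X ⟩
    m * d + (r₁ * m + r₂ * X)                ∎))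
  where
  D = (d + r₁) * (d + r₂)
  m = r₁ * r₂ * n
  X = x * D
  e-eliminated : r₂ * s₁ + r₁ * x ≡ r₁ * s₂ + r₂ * x
  e-eliminated = begin
    r₂ * s₁ + r₁ * x     ≡⟨ cong (_+ r₁ * x) pair₂ ⟨
    e + r₂ * x + r₁ * x  ≡⟨ +-right-comm e (r₂ * x) (r₁ * x) ⟩
    e + r₁ * x + r₂ * x  ≡⟨ cong (_+ r₂ * x) pair₁ ⟩
    r₁ * s₂ + r₂ * x     ∎
  expand₁ : ∀ d r₁ r₂ s x → (r₂ * s + r₁ * x) * ((d + r₁) * (d + r₂))
                          ≡ r₂ * (d + r₂) * ((d + r₁) * s) + r₁ * (x * ((d + r₁) * (d + r₂)))
  expand₁ = solve-∀
  expand₂ : ∀ d r₁ r₂ s x → (r₁ * s + r₂ * x) * ((d + r₁) * (d + r₂))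
                          ≡ r₁ * (d + r₁) * ((d + r₂) * s) + r₂ * (x * ((d + r₁) * (d + r₂)))
  expand₂ = solve-∀
  collect₁ : ∀ n d r₁ r₂ X → r₂ * (d + r₂) * (r₁ * n) + r₁ * X
                           ≡ r₁ * r₂ * n * d + (r₁ * X + r₂ * (r₁ * r₂ * n))
  collect₁ = solve-∀
  collect₂ : ∀ n d r₁ r₂ X → r₁ * (d + r₁) * (r₂ * n) + r₂ * X
                           ≡ r₁ * r₂ * n * d + (r₁ * (r₁ * r₂ * n) + r₂ * X)
  collect₂ = solve-∀

intersection-product : ∀ {n d r₁ r₂ s₁ s₂ x} .{{_ : NonZero ((d + r₁) * (d + r₂))}} →
  (d + r₁) * s₁ ≡ r₁ * n → (d + r₂) * s₂ ≡ r₂ * n →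
  x * ((d + r₁) * (d + r₂)) ≡ r₁ * r₂ * n → x * n ≡ s₁ * s₂
intersection-product {n} {d} {r₁} {r₂} {s₁} {s₂} {x} size₁ size₂ count =
  *-cancelʳ-≡ (x * n) (s₁ * s₂) D (begin
    x * n * D                          ≡⟨ *-right-comm x n D ⟩
    x * D * n                          ≡⟨ cong (_* n) count ⟩
    r₁ * r₂ * n * n                    ≡⟨ xy·z·z≡xz·yz r₁ r₂ n ⟩
    (r₁ * n) * (r₂ * n)                ≡⟨ cong₂ _*_ size₁ size₂ ⟨
    ((d + r₁) * s₁) * ((d + r₂) * s₂)  ≡⟨ xy·zw≡yw·xz (d + r₁) s₁ (d + r₂) s₂ ⟩
    s₁ * s₂ * D                        ∎)
  where
  D = (d + r₁) * (d + r₂)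
  xy·z·z≡xz·yz : ∀ x y z → x * y * z * z ≡ (x * z) * (y * z)
  xy·z·z≡xz·yz = solve-∀
  xy·zw≡yw·xz : ∀ x y z w → (x * y) * (z * w) ≡ y * w * (x * z)
  xy·zw≡yw·xz = solve-∀

distinct-bounded⇒nonZero : ∀ {d r₁ r₂} → r₁ ≤ d → r₂ ≤ d → r₁ ≢ r₂ → NonZero ((d + r₁) * (d + r₂))
distinct-bounded⇒nonZero {suc d} _   _   _     = _
distinct-bounded⇒nonZero {zero}  z≤n z≤n r₁≢r₂ = ⊥-elim (r₁≢r₂ refl)

lemma4p3 : ∀ {n d r₁ r₂ : ℕ} (G : Graph n) (S₁ S₂ : Subset n) →
    Regular G d → r₁ ≤ d → r₂ ≤ d → IndepExactCover G r₁ S₁ → IndepExactCover G r₂ S₂ → r₁ ≢ r₂ →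
    (∣ S₁ ∩ S₂ ∣ * n ≡ ∣ S₁ ∣ * ∣ S₂ ∣)
      × (∣ S₁ ∩ S₂ ∣ * ((d + r₁) * (d + r₂)) ≡ r₁ * r₂ * n)
lemma4p3 {n} {d} {r₁} {r₂} G S₁ S₂ reg r₁≤d r₂≤d cover₁ cover₂ r₁≢r₂ = product , count
  where
  open Adjacency G
  size₁ : (d + r₁) * ∣ S₁ ∣ ≡ r₁ * n
  size₁ = cover-size reg cover₁
  size₂ : (d + r₂) * ∣ S₂ ∣ ≡ r₂ * n
  size₂ = cover-size reg cover₂
  pair₁ : ⟨ χ S₁ , A· χ S₂ ⟩ + r₁ * ∣ S₁ ∩ S₂ ∣ ≡ r₁ * ∣ S₂ ∣
  pair₁ = trans (cong₂ (λ a p → a + r₁ * ∣ p ∣) (⟨f,A·g⟩≡⟨g,A·f⟩ (χ S₁) (χ S₂)) (∩-comm S₁ S₂))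
                (cover-intersection cover₁ S₂)
  count : ∣ S₁ ∩ S₂ ∣ * ((d + r₁) * (d + r₂)) ≡ r₁ * r₂ * n
  count = intersection-equation {d = d} r₁≢r₂ size₁ size₂ (cover-intersection cover₂ S₁) pair₁
  product : ∣ S₁ ∩ S₂ ∣ * n ≡ ∣ S₁ ∣ * ∣ S₂ ∣
  product = intersection-product {d = d} {x = ∣ S₁ ∩ S₂ ∣} {{distinct-bounded⇒nonZero r₁≤d r₂≤d r₁≢r₂}}
                                 size₁ size₂ count
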